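{- Let $G$ be a finite group with trivial center and let $n_0\ge3$ be an integer such that $l^i(D_1,\dots,D_n)\ge1$ for every class vector $(D_1,\dots,D_n)$ of $G$ of every length $n\in\{n_0,n_0+1,\dots,2n_0-1\}$. Then $$l^i(C_1,\dots,C_m)\ge|G|^{k-1}$$ for every class vector $(C_1,\dots,C_m)$ of $G$ of length $m=k\cdot n_0+l$ with $l\in\{0,1,\dots,n_0-1\}$ and $k\ge2$.
   Context: A class vector of a finite group $G$ is a tuple of non-trivial conjugacy classes. $\Sigma^i(C_1,\dots,C_m)$ is the set of classes $[\sigma_1,\dots,\sigma_m]$, modulo simultaneous conjugation by $G$, of tuples with $\sigma_i\in C_i$, $\langle\sigma_1,\dots,\sigma_m\rangle=G$ and $\sigma_1\cdots\sigma_m=\iota$, and $l^i(C_1,\dots,C_m)=|\Sigma^i(C_1,\dots,C_m)|$. -}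

module Defs where

open import Data.Nat using (ℕ; zero; suc)
open import Data.Fin using (Fin; zero; suc)
open import Data.Product using (Σ; ∃; _×_; _,_)
open import Relation.Binary.PropositionalEquality using (_≡_; _≢_)
open import Function using (_∘_)

-- A finite group of order N, realised on the carrier Fin N
-- (every finite group is isomorphic to one of this form).
record FinGroup (N : ℕ) : Set where
  infixl 7 _∙_
  field
    _∙_   : Fin N → Fin N → Fin N
    e     : Fin N
    inv   : Fin N → Fin N
    assoc : ∀ x y z → (x ∙ y) ∙ z ≡ x ∙ (y ∙ z)
    idˡ   : ∀ x → e ∙ x ≡ x
    invˡ  : ∀ x → inv x ∙ x ≡ e

module _ {N : ℕ} (G : FinGroup N) where
  open FinGroup G

  TrivialCenter : Set
  TrivialCenter = ∀ z → (∀ g → z ∙ g ≡ g ∙ z) → z ≡ e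

  conj : Fin N → Fin N → Fin N
  conj g x = g ∙ x ∙ inv g

  InClass : Fin N → Fin N → Set
  InClass x c = ∃ λ g → x ≡ conj g c

  -- A class vector of length m, given by representatives c i of the classes C_i;
  -- each class must be non-trivial.
  IsClassVector : ∀ {m} → (Fin m → Fin N) → Set
  IsClassVector c = ∀ i → c i ≢ e

  prod : ∀ {m} → (Fin m → Fin N) → Fin N
  prod {zero}  σ = e
  prod {suc m} σ = σ zero ∙ prod (σ ∘ suc)

  data InGen {m} (σ : Fin m → Fin N) : Fin N → Set where
    gen  : ∀ i → InGen σ (σ i)
    unit : InGen σ e
    mul  : ∀ {x y} → InGen σ x → InGen σ y → InGen σ (x ∙ y)
    invc : ∀ {x} → InGen σ x → InGen σ (inv x)

  Generates : ∀ {m} → (Fin m → Fin N) → Set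
  Generates σ = ∀ g → InGen σ g

  InΣi : ∀ {m} → (Fin m → Fin N) → (Fin m → Fin N) → Set
  InΣi c σ = (∀ i → InClass (σ i) (c i)) × Generates σ × prod σ ≡ e

  SimConj : ∀ {m} → (Fin m → Fin N) → (Fin m → Fin N) → Set
  SimConj σ τ = ∃ λ g → ∀ i → τ i ≡ conj g (σ i)

  -- l^i(C_1,…,C_m) ≥ M : there are M elements of Σ^i(C) (tuples representing
  -- pairwise distinct simultaneous-conjugacy classes), i.e. an injection
  -- Fin M ↪ Σ^i(C).
  li≥ : ∀ {m} → (Fin m → Fin N) → ℕ → Set
  li≥ {m} c M = Σ (Fin M → Fin m → Fin N) λ f →
    (∀ j → InΣi c (f j)) × (∀ j j′ → SimConj (f j) (f j′) → j ≡ j′)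

-- Conjugating one solution τ of a class vector by every g ∈ G and concatenating
-- with each of M pairwise non-conjugate solutions of a second class vector gives
-- N·M pairwise non-conjugate solutions of the concatenation: a simultaneous
-- conjugator fixes the generating right-hand part, so it is central, hence
-- trivial; then the two conjugators of τ agree, since only 1 centralises the
-- generating tuple τ. Writing k·n₀ + l = (k − 1)·n₀ + (n₀ + l) and iterating
-- over the k − 1 blocks of length n₀ gives the bound N^(k−1).
module Submission where

open import Defs
open import Algebra.Bundles using (Group)
open import Data.Fin using (Fin; zero; suc; _↑ˡ_; _↑ʳ_; splitAt; remQuot)
open import Data.Fin.Properties using (splitAt⁻¹-↑ˡ; splitAt⁻¹-↑ʳ; *↔×)
open import Data.Nat using (ℕ; zero; suc; _+_; _*_; _∸_; _^_; _≤_; _<_; s≤s; z≤n)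
open import Data.Nat.Properties using (+-assoc; +-comm; +-identityʳ; +-monoʳ-<; m≤m+n; ≤-refl; ≤-trans)
open import Data.Product using (_×_; _,_; proj₁; proj₂)
open import Data.Sum using (inj₁; inj₂)
open import Data.Sum.Properties using ([,]-map; [,]-∘)
open import Data.Vec.Functional using (_++_)
open import Data.Vec.Functional.Properties using (lookup-++ʳ; ++-injective)
open import Function using (_∘_; Injection)
open import Function.Properties.Inverse using (↔⇒↣)
open import Level using (0ℓ)
open import Relation.Binary.PropositionalEquality

module _ {N : ℕ} (G : FinGroup N) where
  open FinGroup G
  open ≡-Reasoning

  invʳ : ∀ x → x ∙ inv x ≡ e
  invʳ x = begin
    y                     ≡⟨ idˡ y ⟨
    e ∙ y                 ≡⟨ cong (_∙ y) (invˡ y) ⟨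
    inv y ∙ y ∙ y         ≡⟨ assoc (inv y) y y ⟩
    inv y ∙ (y ∙ y)       ≡⟨ cong (inv y ∙_) y∙y≡y ⟩
    inv y ∙ y             ≡⟨ invˡ y ⟩
    e                     ∎
    where
    y = x ∙ inv x
    y∙y≡y : y ∙ y ≡ y
    y∙y≡y = begin
      x ∙ inv x ∙ (x ∙ inv x)   ≡⟨ assoc x (inv x) (x ∙ inv x) ⟩
      x ∙ (inv x ∙ (x ∙ inv x)) ≡⟨ cong (x ∙_) (assoc (inv x) x (inv x)) ⟨
      x ∙ (inv x ∙ x ∙ inv x)   ≡⟨ cong (λ z → x ∙ (z ∙ inv x)) (invˡ x) ⟩
      x ∙ (e ∙ inv x)           ≡⟨ cong (x ∙_) (idˡ (inv x)) ⟩
      x ∙ inv x                 ∎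

  idʳ : ∀ x → x ∙ e ≡ x
  idʳ x = begin
    x ∙ e             ≡⟨ cong (x ∙_) (invˡ x) ⟨
    x ∙ (inv x ∙ x)   ≡⟨ assoc x (inv x) x ⟨
    x ∙ inv x ∙ x     ≡⟨ cong (_∙ x) (invʳ x) ⟩
    e ∙ x             ≡⟨ idˡ x ⟩
    x                 ∎

  group : Group 0ℓ 0ℓ
  group = record
    { _≈_     = _≡_
    ; _∙_     = _∙_
    ; ε       = e
    ; _⁻¹     = inv
    ; isGroup = record
      { isMonoid = record
        { isSemigroup = record
          { isMagma = record { isEquivalence = isEquivalence ; ∙-cong = cong₂ _∙_ }
          ; assoc   = assoc
          }
        ; identity = idˡ , idʳ
        }
      ; inverse = invˡ , invʳ
      ; ⁻¹-cong = cong inv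
      }
    }

  open import Algebra.Properties.Group group
    using (inverseˡ-unique; ε⁻¹≈ε; ⁻¹-anti-homo-∙; ⁻¹-injective)

  conj-∙ : ∀ g a b → conj G g (a ∙ b) ≡ conj G g a ∙ conj G g b
  conj-∙ g a b = begin
    g ∙ (a ∙ b) ∙ inv g                   ≡⟨ cong (_∙ inv g) (assoc g a b) ⟨
    g ∙ a ∙ b ∙ inv g                     ≡⟨ cong (λ z → z ∙ b ∙ inv g) (idʳ (g ∙ a)) ⟨
    g ∙ a ∙ e ∙ b ∙ inv g                 ≡⟨ cong (λ z → g ∙ a ∙ z ∙ b ∙ inv g) (invˡ g) ⟨
    g ∙ a ∙ (inv g ∙ g) ∙ b ∙ inv g       ≡⟨ cong (λ z → z ∙ b ∙ inv g) (assoc (g ∙ a) (inv g) g) ⟨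
    g ∙ a ∙ inv g ∙ g ∙ b ∙ inv g         ≡⟨ cong (_∙ inv g) (assoc (g ∙ a ∙ inv g) g b) ⟩
    g ∙ a ∙ inv g ∙ (g ∙ b) ∙ inv g       ≡⟨ assoc (g ∙ a ∙ inv g) (g ∙ b) (inv g) ⟩
    g ∙ a ∙ inv g ∙ (g ∙ b ∙ inv g)       ∎

  conj-e : ∀ g → conj G g e ≡ e
  conj-e g = trans (cong (_∙ inv g) (idʳ g)) (invʳ g)

  conj-inv : ∀ g a → conj G g (inv a) ≡ inv (conj G g a)
  conj-inv g a = inverseˡ-unique _ _ (begin
    conj G g (inv a) ∙ conj G g a ≡⟨ conj-∙ g (inv a) a ⟨
    conj G g (inv a ∙ a)          ≡⟨ cong (conj G g) (invˡ a) ⟩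
    conj G g e                    ≡⟨ conj-e g ⟩
    e                             ∎)

  conj-identity : ∀ a → conj G e a ≡ a
  conj-identity a = begin
    e ∙ a ∙ inv e   ≡⟨ cong (e ∙ a ∙_) ε⁻¹≈ε ⟩
    e ∙ a ∙ e       ≡⟨ idʳ (e ∙ a) ⟩
    e ∙ a           ≡⟨ idˡ a ⟩
    a               ∎

  conj-∘ : ∀ g h a → conj G g (conj G h a) ≡ conj G (g ∙ h) a
  conj-∘ g h a = begin
    g ∙ (h ∙ a ∙ inv h) ∙ inv g     ≡⟨ cong (_∙ inv g) (assoc g (h ∙ a) (inv h)) ⟨
    g ∙ (h ∙ a) ∙ inv h ∙ inv g     ≡⟨ cong (λ z → z ∙ inv h ∙ inv g) (assoc g h a) ⟨
    g ∙ h ∙ a ∙ inv h ∙ inv g       ≡⟨ assoc (g ∙ h ∙ a) (inv h) (inv g) ⟩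
    g ∙ h ∙ a ∙ (inv h ∙ inv g)     ≡⟨ cong (g ∙ h ∙ a ∙_) (⁻¹-anti-homo-∙ g h) ⟨
    g ∙ h ∙ a ∙ inv (g ∙ h)         ∎

  conj-prod : ∀ {m} g (σ : Fin m → Fin N) → prod G (conj G g ∘ σ) ≡ conj G g (prod G σ)
  conj-prod {zero}  g σ = sym (conj-e g)
  conj-prod {suc m} g σ = begin
    conj G g (σ zero) ∙ prod G (conj G g ∘ σ ∘ suc)  ≡⟨ cong (conj G g (σ zero) ∙_) (conj-prod g (σ ∘ suc)) ⟩
    conj G g (σ zero) ∙ conj G g (prod G (σ ∘ suc))  ≡⟨ conj-∙ g (σ zero) (prod G (σ ∘ suc)) ⟨
    conj G g (prod G σ)                              ∎

  conj-fixes-InGen : ∀ {m} {σ : Fin m → Fin N} x → (∀ i → conj G x (σ i) ≡ σ i) →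
    ∀ {a} → InGen G σ a → conj G x a ≡ a
  conj-fixes-InGen x fix (gen i) = fix i
  conj-fixes-InGen x fix unit = conj-e x
  conj-fixes-InGen x fix (mul {a} {b} p q) = begin
    conj G x (a ∙ b)            ≡⟨ conj-∙ x a b ⟩
    conj G x a ∙ conj G x b     ≡⟨ cong₂ _∙_ (conj-fixes-InGen x fix p) (conj-fixes-InGen x fix q) ⟩
    a ∙ b                       ∎
  conj-fixes-InGen x fix (invc {a} p) =
    trans (conj-inv x a) (cong inv (conj-fixes-InGen x fix p))

  conj-fixed⇒comm : ∀ x a → conj G x a ≡ a → x ∙ a ≡ a ∙ x
  conj-fixed⇒comm x a fixed = begin
    x ∙ a                 ≡⟨ idʳ (x ∙ a) ⟨
    x ∙ a ∙ e             ≡⟨ cong (x ∙ a ∙_) (invˡ x) ⟨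
    x ∙ a ∙ (inv x ∙ x)   ≡⟨ assoc (x ∙ a) (inv x) x ⟨
    x ∙ a ∙ inv x ∙ x     ≡⟨ cong (_∙ x) fixed ⟩
    a ∙ x                 ∎

  conj-InGen : ∀ {m} {σ : Fin m → Fin N} g → ∀ {a} → InGen G σ a → InGen G (conj G g ∘ σ) (conj G g a)
  conj-InGen g (gen i) = gen i
  conj-InGen g unit = subst (InGen G _) (sym (conj-e g)) unit
  conj-InGen g (mul {a} {b} p q) = subst (InGen G _) (sym (conj-∙ g a b)) (mul (conj-InGen g p) (conj-InGen g q))
  conj-InGen g (invc {a} p) = subst (InGen G _) (sym (conj-inv g a)) (invc (conj-InGen g p))

  conj-Generates : ∀ {m} {σ : Fin m → Fin N} g → Generates G σ → Generates G (conj G g ∘ σ)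
  conj-Generates g generates x = subst (InGen G _) conj-inverse (conj-InGen g (generates (conj G (inv g) x)))
    where
    conj-inverse : conj G g (conj G (inv g) x) ≡ x
    conj-inverse = begin
      conj G g (conj G (inv g) x)   ≡⟨ conj-∘ g (inv g) x ⟩
      conj G (g ∙ inv g) x          ≡⟨ cong (λ z → conj G z x) (invʳ g) ⟩
      conj G e x                    ≡⟨ conj-identity x ⟩
      x                             ∎

  InClass-conj : ∀ g {x c} → InClass G x c → InClass G (conj G g x) c
  InClass-conj g (h , x≡hc) = g ∙ h , trans (cong (conj G g) x≡hc) (conj-∘ g h _)

  InΣi-conj : ∀ {m} {c σ : Fin m → Fin N} g → InΣi G c σ → InΣi G c (conj G g ∘ σ)
  InΣi-conj {σ = σ} g (classes , generates , prod≡e) =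
      InClass-conj g ∘ classes
    , conj-Generates g generates
    , trans (conj-prod g σ) (trans (cong (conj G g) prod≡e) (conj-e g))

  prod-cong : ∀ {m} {σ τ : Fin m → Fin N} → (∀ i → σ i ≡ τ i) → prod G σ ≡ prod G τ
  prod-cong {zero}  eq = refl
  prod-cong {suc m} eq = cong₂ _∙_ (eq zero) (prod-cong (eq ∘ suc))

  prod-++ : ∀ {n m} (σ : Fin n → Fin N) (τ : Fin m → Fin N) → prod G (σ ++ τ) ≡ prod G σ ∙ prod G τ
  prod-++ {zero}  σ τ = sym (idˡ (prod G τ))
  prod-++ {suc n} σ τ = begin
    σ zero ∙ prod G ((σ ++ τ) ∘ suc)    ≡⟨ cong (σ zero ∙_) (prod-cong (λ i → [,]-map (splitAt n i))) ⟩
    σ zero ∙ prod G (σ ∘ suc ++ τ)      ≡⟨ cong (σ zero ∙_) (prod-++ (σ ∘ suc) τ) ⟩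
    σ zero ∙ (prod G (σ ∘ suc) ∙ prod G τ) ≡⟨ assoc (σ zero) _ _ ⟨
    prod G σ ∙ prod G τ                 ∎

  InGen-mono : ∀ {m k} {σ : Fin m → Fin N} {τ : Fin k → Fin N} → (∀ i → InGen G τ (σ i)) →
    ∀ {a} → InGen G σ a → InGen G τ a
  InGen-mono sub (gen i) = sub i
  InGen-mono sub unit = unit
  InGen-mono sub (mul p q) = mul (InGen-mono sub p) (InGen-mono sub q)
  InGen-mono sub (invc p) = invc (InGen-mono sub p)

  ++-pointwise : ∀ {n m} (R : Fin N → Fin N → Set) (σ : Fin n → Fin N) (τ : Fin m → Fin N)
    (c : Fin (n + m) → Fin N) → (∀ i → R (σ i) (c (i ↑ˡ m))) → (∀ i → R (τ i) (c (n ↑ʳ i))) →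
    ∀ i → R ((σ ++ τ) i) (c i)
  ++-pointwise {n} R σ τ c left right i with splitAt n i in eq
  ... | inj₁ j = subst (R (σ j) ∘ c) (splitAt⁻¹-↑ˡ eq) (left j)
  ... | inj₂ j = subst (R (τ j) ∘ c) (splitAt⁻¹-↑ʳ eq) (right j)

  InΣi-++ : ∀ {n m} {c : Fin (n + m) → Fin N} {σ : Fin n → Fin N} {τ : Fin m → Fin N} →
    InΣi G (c ∘ (_↑ˡ m)) σ → InΣi G (c ∘ (n ↑ʳ_)) τ → InΣi G c (σ ++ τ)
  InΣi-++ {n} {m} {c} {σ} {τ} (classesσ , _ , prodσ≡e) (classesτ , generatesτ , prodτ≡e) =
      ++-pointwise (InClass G) σ τ c classesσ classesτ
    , InGen-mono (λ i → subst (InGen G (σ ++ τ)) (lookup-++ʳ σ τ i) (gen (n ↑ʳ i))) ∘ generatesτ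
    , (begin
      prod G (σ ++ τ)       ≡⟨ prod-++ σ τ ⟩
      prod G σ ∙ prod G τ   ≡⟨ cong₂ _∙_ prodσ≡e prodτ≡e ⟩
      e ∙ e                 ≡⟨ idˡ e ⟩
      e                     ∎)
  conj-++ : ∀ {n m} x (σ : Fin n → Fin N) (τ : Fin m → Fin N) →
    ∀ i → conj G x ((σ ++ τ) i) ≡ (conj G x ∘ σ ++ conj G x ∘ τ) i
  conj-++ {n} x σ τ i = [,]-∘ (conj G x) (splitAt n i)

  SimConj-++ : ∀ {n m} {σ σ′ : Fin n → Fin N} {τ τ′ : Fin m → Fin N} x →
    (∀ i → (σ′ ++ τ′) i ≡ conj G x ((σ ++ τ) i)) →
    (∀ i → σ′ i ≡ conj G x (σ i)) × (∀ i → τ′ i ≡ conj G x (τ i))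
  SimConj-++ {σ = σ} {σ′} {τ} {τ′} x conjugates =
    ++-injective σ′ (conj G x ∘ σ) λ i → trans (conjugates i) (conj-++ x σ τ i)

  li≥-× : ∀ {m A B} {c : Fin m → Fin N} (F : Fin A × Fin B → Fin m → Fin N) →
    (∀ p → InΣi G c (F p)) → (∀ p q → SimConj G (F p) (F q) → p ≡ q) → li≥ G c (A * B)
  li≥-× {A = A} {B} F solutions distinct =
      F ∘ remQuot B
    , solutions ∘ remQuot B
    , λ p q pq → Injection.injective (↔⇒↣ (*↔× {A} {B})) (distinct _ _ pq)

  AllLi≥ : ℕ → ℕ → Set
  AllLi≥ m M = (c : Fin m → Fin N) → IsClassVector G c → li≥ G c M

  module _ (trivialCenter : TrivialCenter G) where

    conj-injective : ∀ {m} {σ : Fin m → Fin N} → Generates G σ →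
      ∀ g h → (∀ i → conj G g (σ i) ≡ conj G h (σ i)) → g ≡ h
    conj-injective {σ = σ} generates g h agree =
      sym (⁻¹-injective (inverseˡ-unique (inv h) g h⁻¹g≡e))
      where
      fixes : ∀ i → conj G (inv h ∙ g) (σ i) ≡ σ i
      fixes i = begin
        conj G (inv h ∙ g) (σ i)          ≡⟨ conj-∘ (inv h) g (σ i) ⟨
        conj G (inv h) (conj G g (σ i))   ≡⟨ cong (conj G (inv h)) (agree i) ⟩
        conj G (inv h) (conj G h (σ i))   ≡⟨ conj-∘ (inv h) h (σ i) ⟩
        conj G (inv h ∙ h) (σ i)          ≡⟨ cong (λ z → conj G z (σ i)) (invˡ h) ⟩
        conj G e (σ i)                    ≡⟨ conj-identity (σ i) ⟩
        σ i                               ∎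

      h⁻¹g≡e : inv h ∙ g ≡ e
      h⁻¹g≡e = trivialCenter (inv h ∙ g) λ a →
        conj-fixed⇒comm (inv h ∙ g) a (conj-fixes-InGen (inv h ∙ g) fixes (generates a))

    li≥-++ : ∀ {n m M} (c : Fin (n + m) → Fin N) →
      li≥ G (c ∘ (_↑ˡ m)) 1 → li≥ G (c ∘ (n ↑ʳ_)) M → li≥ G c (N * M)
    li≥-++ {n} {m} {M} c (τs , τs-sol , _) (σ , σ-sol , σ-distinct) = li≥-× F F-sol F-distinct
      where
      τ = τs zero
      τ-sol = τs-sol zero

      F : Fin N × Fin M → Fin (n + m) → Fin N
      F (g , j) = conj G g ∘ τ ++ σ j

      F-sol : ∀ p → InΣi G c (F p)
      F-sol (g , j) = InΣi-++ (InΣi-conj g τ-sol) (σ-sol j)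

      F-distinct : ∀ p q → SimConj G (F p) (F q) → p ≡ q
      F-distinct (g , j) (g′ , j′) (x , conjugates)
        with left , right ← SimConj-++ x conjugates
        with refl ← σ-distinct j j′ (x , right) = cong (_, j) g≡g′
        where
        x≡e : x ≡ e
        x≡e = conj-injective (proj₁ (proj₂ (σ-sol j))) x e λ i →
          trans (sym (right i)) (sym (conj-identity (σ j i)))

        g≡g′ : g ≡ g′
        g≡g′ = conj-injective (proj₁ (proj₂ τ-sol)) g g′ λ i → begin
          conj G g (τ i)                  ≡⟨ conj-identity (conj G g (τ i)) ⟨
          conj G e (conj G g (τ i))       ≡⟨ cong (λ z → conj G z (conj G g (τ i))) x≡e ⟨
          conj G x (conj G g (τ i))       ≡⟨ left i ⟨
          conj G g′ (τ i)                 ∎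

    AllLi≥-+ : ∀ {n m M} → AllLi≥ n 1 → AllLi≥ m M → AllLi≥ (n + m) (N * M)
    AllLi≥-+ {n} {m} first rest c nontrivial =
      li≥-++ c (first _ (nontrivial ∘ (_↑ˡ m))) (rest _ (nontrivial ∘ (n ↑ʳ_)))

    AllLi≥-*+ : ∀ {n r} → AllLi≥ n 1 → AllLi≥ r 1 → ∀ j → AllLi≥ (j * n + r) (N ^ j)
    AllLi≥-*+ block rest zero = rest
    AllLi≥-*+ {n} {r} block rest (suc j) =
      subst (λ m → AllLi≥ m (N ^ suc j)) (sym (+-assoc n (j * n) r))
        (AllLi≥-+ block (AllLi≥-*+ block rest j))

-- The hypothesis 3 ≤ n₀ enters only through n₀ > 0.
proposition13 : ∀ {N : ℕ} (G : FinGroup N) → TrivialCenter G →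
    (n₀ : ℕ) → 3 ≤ n₀ →
    (∀ (n : ℕ) → n₀ ≤ n → n < 2 * n₀ →
    (D : Fin n → Fin N) → IsClassVector G D → li≥ G D 1) →
    ∀ (k l : ℕ) → l < n₀ → 2 ≤ k →
    (C : Fin (k * n₀ + l) → Fin N) → IsClassVector G C →
    li≥ G C (N ^ (k ∸ 1))
proposition13 {N} G trivialCenter n₀ 3≤n₀ short k l l<n₀ (s≤s (s≤s {n = j} _)) =
  subst (λ m → AllLi≥ G m (N ^ suc j)) length-split
    (AllLi≥-*+ G trivialCenter block rest (suc j))
  where
  n₀+x<2n₀ : ∀ {x} → x < n₀ → n₀ + x < 2 * n₀
  n₀+x<2n₀ {x} x<n₀ = +-monoʳ-< n₀ (subst (x <_) (sym (+-identityʳ n₀)) x<n₀)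

  block : AllLi≥ G n₀ 1
  block = short n₀ ≤-refl
    (subst (_< 2 * n₀) (+-identityʳ n₀) (n₀+x<2n₀ (≤-trans (s≤s z≤n) 3≤n₀)))

  rest : AllLi≥ G (n₀ + l) 1
  rest = short (n₀ + l) (m≤m+n n₀ l) (n₀+x<2n₀ l<n₀)

  length-split : suc j * n₀ + (n₀ + l) ≡ suc (suc j) * n₀ + l
  length-split = trans (sym (+-assoc (suc j * n₀) n₀ l)) (cong (_+ l) (+-comm (suc j * n₀) n₀))
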